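{- For all $\phi,\psi\in\Phi$ and $\alpha\in\Phi_{XY}$, the following formulas are valid: (1a) $\mathtt{X}\neg\phi\leftrightarrow\neg\mathtt{X}\phi$; (1b) $\mathtt{X}(\phi\land\psi)\leftrightarrow(\mathtt{X}\phi\land\mathtt{X}\psi)$; (1c) $\mathtt{X}\mathtt{Y}\phi\leftrightarrow\phi$; (1d) $\mathtt{X}[\alpha]\phi\leftrightarrow[\mathtt{X}\alpha]\mathtt{X}\phi$; (2a) $\mathtt{Y}\neg\phi\leftrightarrow(\mathtt{Y}\bot\lor\neg\mathtt{Y}\phi)$; (2b) $\mathtt{Y}(\phi\land\psi)\leftrightarrow(\mathtt{Y}\phi\land\mathtt{Y}\psi)$; (2c) $\mathtt{Y}\mathtt{X}\phi\leftrightarrow(\mathtt{Y}\bot\lor\phi)$; (2d) $\mathtt{Y}[\alpha]\phi\leftrightarrow[\mathtt{Y}\alpha]\mathtt{Y}\phi$.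
   Context: Let $\mathsf{AP}$ be a countable set of atomic propositions. The language $\Phi_{XY}$ is given by $\alpha ::= p \mid \bot \mid \neg\alpha \mid (\alpha\land\alpha) \mid \mathtt{X}\alpha \mid \mathtt{Y}\alpha$ with $p\in\mathsf{AP}$. The language $\Phi$ is given by $\phi ::= p \mid \bot \mid \neg\phi \mid (\phi\land\phi) \mid \mathtt{X}\phi \mid \mathtt{Y}\phi \mid [\alpha]\phi$ with $\alpha\in\Phi_{XY}$. Abbreviations: $\top,\lor,\rightarrow,\leftrightarrow$ as usual. A model is $M=(W,<,V)$ where $W$ is a nonempty set, $<$ is a serial binary relation on $W$ such that there is $r\in W$ (the root) with: for every $w\in W$ there is a unique finite sequence $x_0,\dots,x_n$ with $x_0=r$, $x_n=w$, $x_0<x_1<\dots<x_n$; and $V:\mathsf{AP}\to\mathcal P(W)$. A timeline is an infinite sequence $\pi=x_0,x_1,\dots$ with $x_0=r$ and $x_k<x_{k+1}$ for all $k$; $\pi[i]:=x_i$; $TL(M)$ is the set of timelines; instants are natural numbers. A context for $M$ is a finite (possibly empty) set $C$ of subsets of $TL(M)$; $AT(C):=TL(M)\cap\bigcap_{R\in C}R$. A contextualized pointed model is $(M,C,\pi,i)$ with $C$ a context for $M$, $\pi\in AT(C)$, $i\in\mathbb N$. Satisfaction $M,C,\pi,i\Vdash\phi$ (for $\pi\in TL(M)$): $p$ iff $\pi[i]\in V(p)$; $\bot$ never; $\neg,\land$ classically; $\mathtt{X}\phi$ iff $M,C,\pi,i+1\Vdash\phi$; $\mathtt{Y}\phi$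 iff $i=0$ or $M,C,\pi,i-1\Vdash\phi$; $[\alpha]\phi$ iff $M,C^{\alpha}_i,\pi',i\Vdash\phi$ for every $\pi'\in AT(C^{\alpha}_i)$, where $C^{\alpha}_i:=C\cup\{\|\alpha\|_i\}$ and $\|\alpha\|_i:=\{\pi'\in TL(M): M,C,\pi',i\Vdash\alpha\}$. A formula is valid if it is true at every contextualized pointed model. -}

module Defs where

open import Data.Nat using (ℕ; zero; suc)
open import Data.List using (List; []; _∷_; head; last)
open import Data.Maybe using (just)
open import Data.Product using (Σ; ∃; _×_; _,_)
open import Data.Unit using (⊤)
open import Data.Empty using (⊥)
open import Relation.Nullary using (¬_)
open import Relation.Binary.PropositionalEquality using (_≡_)

AP : Set
AP = ℕ

data FormXY : Set where
  atom : AP → FormXY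
  ⊥' : FormXY
  ¬' : FormXY → FormXY
  _∧'_ : FormXY → FormXY → FormXY
  X' : FormXY → FormXY
  Y' : FormXY → FormXY

data Form : Set where
  atom : AP → Form
  ⊥' : Form
  ¬' : Form → Form
  _∧'_ : Form → Form → Form
  X' : Form → Form
  Y' : Form → Form
  [_]'_ : FormXY → Form → Form

ι : FormXY → Form
ι (atom p) = atom p
ι ⊥' = ⊥'
ι (¬' a) = ¬' (ι a)
ι (a ∧' b) = ι a ∧' ι b
ι (X' a) = X' (ι a)
ι (Y' a) = Y' (ι a)

⊤' : Form
⊤' = ¬' ⊥'

_∨'_ : Form → Form → Form
a ∨' b = ¬' (¬' a ∧' ¬' b)

_⇒'_ : Form → Form → Form
a ⇒' b = ¬' (a ∧' ¬' b)

_⇔'_ : Form → Form → Form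
a ⇔' b = (a ⇒' b) ∧' (b ⇒' a)

module _ {W : Set} (_<_ : W → W → Set) where
  Chain : List W → Set
  Chain [] = ⊥
  Chain (x ∷ []) = ⊤
  Chain (x ∷ y ∷ ys) = (x < y) × Chain (y ∷ ys)

  PathFromTo : W → W → List W → Set
  PathFromTo r w xs = (head xs ≡ just r) × (last xs ≡ just w) × Chain xs

record Model : Set₁ where
  field
    W : Set
    _<_ : W → W → Set
    serial : ∀ w → ∃ λ v → w < v
    root : W
    uniquePath : ∀ w → Σ (List W) λ xs →
      PathFromTo _<_ root w xs × (∀ ys → PathFromTo _<_ root w ys → ys ≡ xs)
    V : AP → W → Set

module _ (M : Model) where
  open Model M

  record Timeline : Set where
    constructor tl
    field
      seq : ℕ → W
      starts : seq 0 ≡ root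
      steps : ∀ k → seq k < seq (suc k)

  Context : Set₁
  Context = List (Timeline → Set)

  AT : Context → Timeline → Set
  AT [] π = ⊤
  AT (R ∷ C) π = R π × AT C π

  -- Satisfaction for Φ_XY formulas (the same clauses as for Φ; the context
  -- argument is carried along but, as in the paper, not used by these clauses).
  satXY : Context → Timeline → ℕ → FormXY → Set
  satXY C π i (atom p) = V p (Timeline.seq π i)
  satXY C π i ⊥' = ⊥
  satXY C π i (¬' α) = ¬ satXY C π i α
  satXY C π i (α ∧' β) = satXY C π i α × satXY C π i β
  satXY C π i (X' α) = satXY C π (suc i) α
  satXY C π zero (Y' α) = ⊤
  satXY C π (suc i) (Y' α) = satXY C π i α

  ext : Context → ℕ → FormXY → Timeline → Set
  ext C i α π' = satXY C π' i α

  sat : Context → Timeline → ℕ → Form → Set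
  sat C π i (atom p) = V p (Timeline.seq π i)
  sat C π i ⊥' = ⊥
  sat C π i (¬' φ) = ¬ sat C π i φ
  sat C π i (φ ∧' ψ) = sat C π i φ × sat C π i ψ
  sat C π i (X' φ) = sat C π (suc i) φ
  sat C π zero (Y' φ) = ⊤
  sat C π (suc i) (Y' φ) = sat C π i φ
  sat C π i ([ α ]' φ) = ∀ π' → AT (ext C i α ∷ C) π' → sat (ext C i α ∷ C) π' i φ

Valid : Form → Set₁
Valid φ = ∀ (M : Model) (C : Context M) (π : Timeline M) → AT M C π → ∀ (i : ℕ) → sat M C π i φ

{-# OPTIONS --safe #-}
-- Each X-law holds because its two sides have the same truth condition; for (1d) the
-- point is that ‖X α‖ at i is ‖α‖ at i + 1, so X [α] φ and [X α] X φ refine the context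
-- by the same set of timelines.  The Y-laws hold at positive instants, where Y ⊥ is false,
-- for the same reason, while at instant 0 every Y-formula, Y ⊥ included, is true.
module Submission where

open import Defs
open import Data.Product using (_×_; _,_)
open import Data.Nat using (zero; suc)
open import Data.Unit using (tt)
open import Function using (id; _∘_)
open import Relation.Nullary using (¬_)
open import Relation.Nullary.Negation using (contradiction)

-- Entailment only up to double negation: that is all that φ ⇒' ψ = ¬' (φ ∧' ¬' ψ) asks for.
Entails : Form → Form → Set₁
Entails φ ψ = ∀ {M C π i} → sat M C π i φ → ¬ ¬ sat M C π i ψ

valid-⇔' : ∀ φ ψ → Entails φ ψ → Entails ψ φ → Valid (φ ⇔' ψ)
valid-⇔' φ ψ φ⊨ψ ψ⊨φ M C π _ i =
  (λ (a , ¬b) → φ⊨ψ a ¬b) , (λ (b , ¬a) → ψ⊨φ b ¬a)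

valid-⇔'-refl : ∀ φ → Valid (φ ⇔' φ)
valid-⇔'-refl φ = valid-⇔' φ φ contradiction contradiction

entails-by-instant : ∀ φ ψ →
  (∀ {M C π} → sat M C π 0 ψ) →
  (∀ {M C π i} → sat M C π (suc i) φ → sat M C π (suc i) ψ) →
  Entails φ ψ
entails-by-instant φ ψ ψ₀ φ⇒ψ {i = zero}  _ = contradiction ψ₀
entails-by-instant φ ψ ψ₀ φ⇒ψ {i = suc i} a = contradiction (φ⇒ψ a)

valid-⇔'-by-instant : ∀ φ ψ →
  (∀ {M C π} → sat M C π 0 φ) →
  (∀ {M C π} → sat M C π 0 ψ) →
  (∀ {M C π i} → sat M C π (suc i) φ → sat M C π (suc i) ψ) →
  (∀ {M C π i} → sat M C π (suc i) ψ → sat M C π (suc i) φ) →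
  Valid (φ ⇔' ψ)
valid-⇔'-by-instant φ ψ φ₀ ψ₀ φ⇒ψ ψ⇒φ =
  valid-⇔' φ ψ (entails-by-instant φ ψ ψ₀ φ⇒ψ) (entails-by-instant ψ φ φ₀ ψ⇒φ)

valid-⇔'-Y⊥∨' : ∀ θ χ →
  (∀ {M C π} → sat M C π 0 θ) →
  (∀ {M C π i} → sat M C π (suc i) θ → sat M C π (suc i) χ) →
  (∀ {M C π i} → sat M C π (suc i) χ → sat M C π (suc i) θ) →
  Valid (θ ⇔' (Y' ⊥' ∨' χ))
valid-⇔'-Y⊥∨' θ χ θ₀ θ⇒χ χ⇒θ =
  valid-⇔' θ (Y' ⊥' ∨' χ) (entails-by-instant θ (Y' ⊥' ∨' χ) initially later) Y⊥∨χ⊨θ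
  where
  initially : ∀ {M C π} → sat M C π 0 (Y' ⊥' ∨' χ)
  initially (¬Y⊥ , _) = ¬Y⊥ tt

  later : ∀ {M C π i} → sat M C π (suc i) θ → sat M C π (suc i) (Y' ⊥' ∨' χ)
  later a (_ , ¬χ) = ¬χ (θ⇒χ a)

  Y⊥∨χ⊨θ : Entails (Y' ⊥' ∨' χ) θ
  Y⊥∨χ⊨θ {i = zero}  _ = contradiction θ₀
  Y⊥∨χ⊨θ {i = suc i} Y⊥∨χ ¬θ = Y⊥∨χ ((λ ()) , ¬θ ∘ χ⇒θ)

lemma1 : ∀ (φ ψ : Form) (α : FormXY) →
    Valid (X' (¬' φ) ⇔' ¬' (X' φ))
    × Valid (X' (φ ∧' ψ) ⇔' (X' φ ∧' X' ψ))
    × Valid (X' (Y' φ) ⇔' φ)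
    × Valid (X' ([ α ]' φ) ⇔' ([ X' α ]' X' φ))
    × Valid (Y' (¬' φ) ⇔' (Y' ⊥' ∨' ¬' (Y' φ)))
    × Valid (Y' (φ ∧' ψ) ⇔' (Y' φ ∧' Y' ψ))
    × Valid (Y' (X' φ) ⇔' (Y' ⊥' ∨' φ))
    × Valid (Y' ([ α ]' φ) ⇔' ([ Y' α ]' Y' φ))
lemma1 φ ψ α =
    valid-⇔'-refl (X' (¬' φ))
  , valid-⇔'-refl (X' (φ ∧' ψ))
  , valid-⇔'-refl φ
  , valid-⇔'-refl (X' ([ α ]' φ))
  , valid-⇔'-Y⊥∨' (Y' (¬' φ)) (¬' (Y' φ)) tt id id
  , valid-⇔'-by-instant (Y' (φ ∧' ψ)) (Y' φ ∧' Y' ψ) tt (tt , tt) id id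
  , valid-⇔'-Y⊥∨' (Y' (X' φ)) φ tt id id
  , valid-⇔'-by-instant (Y' ([ α ]' φ)) ([ Y' α ]' Y' φ) tt (λ _ _ → tt) id id
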